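{- Let $n,m\in\mathbb{N}$ with $n\le m$. Then $\mathscr{S}_m(n)$ is full if and only if $m\le n+4+\frac{4}{n}$. In particular, $\mathscr{S}_m(n)$ is full whenever $n\le m\le 8$.
   Context: $\mathbb{N}$ denotes the positive integers. For $m,n\in\mathbb{N}$, $\mathscr{S}_m(n)$ is the set of all $T\in\mathbb{Z}$ for which there exist $x_1,\ldots,x_m\in\mathbb{Z}$ with $x_1+\cdots+x_m=T$ and $x_1^2+\cdots+x_m^2=n$. Let $\mathscr{T}_m(n)=\{T\in\mathbb{Z}: n\equiv T \pmod 2,\ T^2<mn\}$ and $\mathscr{S}_m'(n)=\{T\in\mathscr{S}_m(n): T^2<mn\}$. $\mathscr{S}_m(n)$ is called full if $\mathscr{S}_m'(n)=\mathscr{T}_m(n)$. -}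

module Defs where

open import Data.Nat as ℕ using (ℕ; zero; suc)
open import Data.Integer as ℤ using (ℤ; +_; _+_; _*_; _-_; _<_)
open import Data.Integer.Divisibility using (_∣_)
open import Data.Fin using (Fin)
open import Data.Product using (Σ; _×_)
open import Relation.Binary.PropositionalEquality using (_≡_)
open import Function.Bundles using (_⇔_)

sumℤ : ∀ {m} → (Fin m → ℤ) → ℤ
sumℤ {zero}  x = + 0
sumℤ {suc m} x = x Fin.zero + sumℤ (λ i → x (Fin.suc i))

sumSq : ∀ {m} → (Fin m → ℤ) → ℤ
sumSq x = sumℤ (λ i → x i * x i)

InS : ℕ → ℕ → ℤ → Set
InS m n T = Σ (Fin m → ℤ) (λ x → (sumℤ x ≡ T) × (sumSq x ≡ + n))

InS' : ℕ → ℕ → ℤ → Set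
InS' m n T = InS m n T × (T * T < + (m ℕ.* n))

InT : ℕ → ℕ → ℤ → Set
InT m n T = ((+ 2) ∣ (+ n - T)) × (T * T < + (m ℕ.* n))

Full : ℕ → ℕ → Set
Full m n = ∀ (T : ℤ) → InS' m n T ⇔ InT m n T

module Submission where

-- Write S ⊑ U when U − S is an even natural number.  Since x² − x = x(x − 1)
-- is even and non-negative, x ⊑ x² for every integer x, and summing gives
-- T ⊑ n for every T ∈ 𝒮_m(n); in particular n ≡ T (mod 2) and T ≤ n.
-- Conversely, if T ⊑ n and −T ⊑ n (that is, |T| ≤ n and T ≡ n mod 2) and
-- n ≤ m, then T = a − b and n = a + b, and T is realised by a vector of a
-- ones, b minus ones and m − n zeros.
-- If m·n ≤ (n+2)², every T ∈ 𝒯_m(n) has T² < (n+2)², so |T| ≤ n + 1, and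
-- parity excludes |T| = n + 1: hence 𝒯_m(n) ⊆ 𝒮_m(n) and 𝒮_m(n) is full.
-- If m·n > (n+2)², the point T = n + 2 lies in 𝒯_m(n) but not in 𝒮_m(n).
-- So fullness is equivalent to m·n ≤ (n+2)², which is the rational
-- condition m ≤ n + 4 + 4/n multiplied by n; finally 8n ≤ (n+2)² by AM–GM.

open import Defs
open import Data.Nat using (ℕ; _≤_; NonZero)
open import Data.Integer using (+_)
open import Data.Rational as ℚ using (_/_)
open import Data.Product using (_×_)
open import Function.Bundles using (_⇔_)

open import Data.Nat as ℕ using (zero; suc; _+_; _*_; _∸_; _<_; z≤n; s≤s)
import Data.Nat.Properties as ℕₚ
open import Data.Nat.Divisibility as ℕ∣ using (divides)
open import Data.Nat.Tactic.RingSolver using (solve-∀)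
open import Data.Integer as ℤ using (ℤ; -[1+_]; _⊖_; ∣_∣)
import Data.Integer.Properties as ℤₚ
open import Data.Integer.Divisibility using (_∣_)
import Data.Integer.Divisibility.Signed as ℤ∣ˢ
import Data.Integer.Tactic.RingSolver as ℤSolver
import Data.Rational.Unnormalised as ℚᵘ
import Data.Rational.Unnormalised.Properties as ℚᵘₚ
import Data.Rational.Properties as ℚₚ
open import Data.Fin using (Fin)
open import Data.Vec.Functional using (_∷_)
open import Data.Product using (Σ; _,_; proj₁)
open import Data.Sum using (inj₁; inj₂)
open import Data.Empty using (⊥-elim)
open import Relation.Nullary using (¬_; yes; no)
open import Relation.Binary.PropositionalEquality
open import Function.Bundles using (mk⇔; Equivalence)
open import Function.Construct.Composition using (_⇔-∘_)
open import Function.Construct.Symmetry using (⇔-sym)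
open ≡-Reasoning

dist-≥ : ∀ {m n} → n ≤ m → ∣ + m ℤ.- + n ∣ ≡ m ∸ n
dist-≥ {m} {n} n≤m = cong ∣_∣ (trans (ℤₚ.[+m]-[+n]≡m⊖n m n) (ℤₚ.⊖-≥ n≤m))

dist-≤ : ∀ {m n} → m ≤ n → ∣ + m ℤ.- + n ∣ ≡ n ∸ m
dist-≤ {m} {n} m≤n = trans (cong ∣_∣ (ℤₚ.[+m]-[+n]≡m⊖n m n)) (ℤₚ.∣⊖∣-≤ m≤n)

2∤1 : ¬ (2 ℕ∣.∣ 1)
2∤1 2∣1 with ℕ∣.∣1⇒≡1 2∣1
... | ()

-- Doubling as used by divisibility: k + k = k·2.
twice : ∀ k → k + k ≡ k * 2
twice = solve-∀

[m+n]⊖m≡n : ∀ m n → (m + n) ⊖ m ≡ + n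
[m+n]⊖m≡n m n = trans (ℤₚ.⊖-≥ (ℕₚ.m≤m+n m n)) (cong +_ (ℕₚ.m+n∸m≡n m n))

square-cancel-< : ∀ t N → t * t < N * N → t < N
square-cancel-< t N sq = ℕₚ.≰⇒> λ N≤t → ℕₚ.<⇒≱ sq (ℕₚ.*-mono-≤ N≤t N≤t)

-- AM–GM for ordered arguments: if b = a + d then (a + b)² = 4ab + d².
am-gm-ordered : ∀ {a b} → a ≤ b → 4 * (a * b) ≤ (a + b) * (a + b)
am-gm-ordered {a} a≤b with ℕₚ.m≤n⇒∃[o]m+o≡n a≤b
... | d , refl = subst (4 * (a * (a + d)) ≤_) (expand a d) (ℕₚ.m≤m+n _ (d * d))
  where
  expand : ∀ a d → 4 * (a * (a + d)) + d * d ≡ (a + (a + d)) * (a + (a + d))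
  expand = solve-∀

am-gm : ∀ a b → 4 * (a * b) ≤ (a + b) * (a + b)
am-gm a b with ℕₚ.≤-total a b
... | inj₁ a≤b = am-gm-ordered a≤b
... | inj₂ b≤a = subst₂ _≤_ (cong (4 *_) (ℕₚ.*-comm b a)) (cong (λ s → s * s) (ℕₚ.+-comm b a))
                        (am-gm-ordered b≤a)

-- The even-gap order: S ⊑ U when U − S is an even natural number.
-- It is a record so that S and U can be recovered from the type.
infix 4 _⊑_
record _⊑_ (S U : ℤ) : Set where
  constructor evenGap
  field
    half : ℕ
    gap  : U ≡ S ℤ.+ + (half + half)

⊑-+ : ∀ {S U S′ U′} → S ⊑ U → S′ ⊑ U′ → (S ℤ.+ S′) ⊑ (U ℤ.+ U′)
⊑-+ {S} {U} {S′} {U′} (evenGap k U≡) (evenGap k′ U′≡) = evenGap (k + k′) (begin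
  U ℤ.+ U′                                       ≡⟨ cong₂ ℤ._+_ U≡ U′≡ ⟩
  (S ℤ.+ + (k + k)) ℤ.+ (S′ ℤ.+ + (k′ + k′))     ≡⟨ interchange S S′ (+ (k + k)) (+ (k′ + k′)) ⟩
  (S ℤ.+ S′) ℤ.+ + ((k + k) + (k′ + k′))         ≡⟨ cong (λ j → (S ℤ.+ S′) ℤ.+ + j) (regroup k k′) ⟩
  (S ℤ.+ S′) ℤ.+ + ((k + k′) + (k + k′))         ∎)
  where
  interchange : ∀ a b c d → (a ℤ.+ c) ℤ.+ (b ℤ.+ d) ≡ (a ℤ.+ b) ℤ.+ (c ℤ.+ d)
  interchange = ℤSolver.solve-∀
  regroup : ∀ k k′ → (k + k) + (k′ + k′) ≡ (k + k′) + (k + k′)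
  regroup = solve-∀

⊑⇒parity : ∀ {S U} → S ⊑ U → + 2 ∣ (U ℤ.- S)
⊑⇒parity {S} (evenGap k refl) = divides k (begin
  ∣ (S ℤ.+ + (k + k)) ℤ.- S ∣  ≡⟨ cong ∣_∣ (cancel S (+ (k + k))) ⟩
  k + k                        ≡⟨ twice k ⟩
  k * 2                        ∎)
  where
  cancel : ∀ a b → (a ℤ.+ b) ℤ.- a ≡ b
  cancel = ℤSolver.solve-∀

⊑⇒≤ : ∀ {t n} → + t ⊑ + n → t ≤ n
⊑⇒≤ {t} (evenGap k n≡) = subst (t ≤_) (sym (ℤₚ.+-injective n≡)) (ℕₚ.m≤m+n t (k + k))

-- For t ≥ 0, t ⊑ n implies −t ⊑ n: n = t + 2k = −t + 2(t + k).
⊑-neg : ∀ {t n} → + t ⊑ + n → ℤ.- + t ⊑ + n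
⊑-neg {t} {n} (evenGap k n≡) = evenGap (t + k) (sym (begin
  ℤ.- + t ℤ.+ + ((t + k) + (t + k))  ≡⟨ ℤₚ.-m+n≡n⊖m t _ ⟩
  ((t + k) + (t + k)) ⊖ t            ≡⟨ cong (_⊖ t) (regroup t k) ⟩
  (t + (t + (k + k))) ⊖ t            ≡⟨ [m+n]⊖m≡n t (t + (k + k)) ⟩
  + t ℤ.+ + (k + k)                  ≡⟨ n≡ ⟨
  + n                                ∎))
  where
  regroup : ∀ t k → (t + k) + (t + k) ≡ t + (t + (k + k))
  regroup = solve-∀

triangle : ℕ → ℕ
triangle zero    = 0
triangle (suc j) = suc j + triangle j

pronic : ∀ j → j * j + j ≡ triangle j + triangle j
pronic zero    = refl
pronic (suc j) = begin
  suc j * suc j + suc j                          ≡⟨ expand j ⟩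
  (j * j + j) + (suc j + suc j)                  ≡⟨ cong (_+ (suc j + suc j)) (pronic j) ⟩
  (triangle j + triangle j) + (suc j + suc j)    ≡⟨ regroup (suc j) (triangle j) ⟩
  (suc j + triangle j) + (suc j + triangle j)    ∎
  where
  expand : ∀ j → (1 + j) * (1 + j) + (1 + j) ≡ (j * j + j) + ((1 + j) + (1 + j))
  expand = solve-∀
  regroup : ∀ a t → (t + t) + (a + a) ≡ (a + t) + (a + t)
  regroup = solve-∀

-- x ⊑ x² for every integer x, as x² − x = x(x − 1) is twice a triangular number.
⊑-square : ∀ x → x ⊑ x ℤ.* x
⊑-square (+ zero)  = evenGap 0 refl
⊑-square (+ suc j) = evenGap (triangle j) (begin
  + suc j ℤ.* + suc j            ≡⟨ ℤₚ.pos-* (suc j) (suc j) ⟨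
  + (suc j * suc j)              ≡⟨ cong +_ (shift j) ⟩
  + (suc j + (j * j + j))        ≡⟨ cong (λ s → + (suc j + s)) (pronic j) ⟩
  + suc j ℤ.+ + (triangle j + triangle j) ∎)
  where
  shift : ∀ j → (1 + j) * (1 + j) ≡ (1 + j) + (j * j + j)
  shift = solve-∀
⊑-square -[1+ j ] = evenGap (triangle (suc j)) (sym (begin
  -[1+ j ] ℤ.+ + (triangle (suc j) + triangle (suc j))  ≡⟨ cong (λ s → -[1+ j ] ℤ.+ + s) (pronic (suc j)) ⟨
  (suc j * suc j + suc j) ⊖ suc j                       ≡⟨ cong (_⊖ suc j) (ℕₚ.+-comm (suc j * suc j) (suc j)) ⟩
  (suc j + suc j * suc j) ⊖ suc j                       ≡⟨ [m+n]⊖m≡n (suc j) (suc j * suc j) ⟩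
  -[1+ j ] ℤ.* -[1+ j ]                                 ∎))

⊑-sumSq : ∀ {m} (x : Fin m → ℤ) → sumℤ x ⊑ sumSq x
⊑-sumSq {zero}  x = evenGap 0 refl
⊑-sumSq {suc m} x = ⊑-+ (⊑-square (x Fin.zero)) (⊑-sumSq (λ i → x (Fin.suc i)))

InS⇒⊑ : ∀ {m n T} → InS m n T → T ⊑ + n
InS⇒⊑ (x , refl , sq≡n) = subst (sumℤ x ⊑_) sq≡n (⊑-sumSq x)

prepend : ∀ {m n T} (c : ℤ) (k : ℕ) → c ℤ.* c ≡ + k → InS m n T → InS (suc m) (k + n) (c ℤ.+ T)
prepend c k c²≡k (x , refl , sq≡n) = c ∷ x , refl , cong₂ ℤ._+_ c²≡k sq≡n

-- a ones, b minus ones and zeros elsewhere: a ⊖ b ∈ 𝒮_m(a + b) whenever a + b ≤ m.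
signVector : ∀ m a b → a + b ≤ m → InS m (a + b) (a ⊖ b)
signVector zero    zero    zero    _         = (λ ()) , refl , refl
signVector (suc m) zero    zero    _         = prepend (+ 0) 0 refl (signVector m 0 0 z≤n)
signVector (suc m) (suc a) b       (s≤s a+b≤m) =
  subst (InS (suc m) (suc a + b)) (ℤₚ.distribʳ-⊖-+-pos 1 a b)
        (prepend (+ 1) 1 refl (signVector m a b a+b≤m))
signVector (suc m) zero    (suc b) (s≤s b≤m) =
  subst (InS (suc m) (suc b)) (ℤₚ.distribʳ-⊖-+-neg 0 0 b)
        (prepend (ℤ.- + 1) 1 refl (signVector m 0 b b≤m))

balance⁺ : ∀ {n t} → + t ⊑ + n → Σ ℕ λ a → Σ ℕ λ b → (a + b ≡ n) × (a ⊖ b ≡ + t)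
balance⁺ {n} {t} (evenGap k n≡) =
  k + t , k , trans (regroup k t) (sym (ℤₚ.+-injective n≡)) , [m+n]⊖m≡n k t
  where
  regroup : ∀ k t → (k + t) + k ≡ t + (k + k)
  regroup = solve-∀

balance : ∀ {n} T → T ⊑ + n → ℤ.- T ⊑ + n → Σ ℕ λ a → Σ ℕ λ b → (a + b ≡ n) × (a ⊖ b ≡ T)
balance (+ t)      t⊑n _ = balance⁺ t⊑n
balance -[1+ t ] _ -T⊑n with balance⁺ -T⊑n
... | a , b , a+b≡n , a⊖b≡-T =
  b , a , trans (ℕₚ.+-comm b a) a+b≡n , trans (ℤₚ.⊖-swap b a) (cong ℤ.-_ a⊖b≡-T)

realise : ∀ {m n} → n ≤ m → ∀ T → T ⊑ + n × ℤ.- T ⊑ + n → InS m n T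
realise {m} n≤m T (T⊑n , -T⊑n) with balance T T⊑n -T⊑n
... | a , b , refl , refl = signVector m a b n≤m

-- n ≡ T (mod 2) is preserved by T ↦ −T, since n + T = (n − T) + 2T.
parity-neg : ∀ {n T} → + 2 ∣ (+ n ℤ.- T) → + 2 ∣ (+ n ℤ.- ℤ.- T)
parity-neg {n} {T} 2∣n-T = ℤ∣ˢ.∣⇒∣ᵤ (subst (ℤ∣ˢ._∣_ (+ 2)) (sym (reflect (+ n) T))
  (ℤ∣ˢ.∣m∣n⇒∣m+n {m = + n ℤ.- T} (ℤ∣ˢ.∣ᵤ⇒∣ 2∣n-T) (ℤ∣ˢ.∣m⇒∣m*n T (ℤ∣ˢ.∣-refl {+ 2}))))
  where
  reflect : ∀ n T → n ℤ.- ℤ.- T ≡ (n ℤ.- T) ℤ.+ + 2 ℤ.* T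
  reflect = ℤSolver.solve-∀

even-gap : ∀ {s n} → s ≤ n → + 2 ∣ (+ n ℤ.- + s) → + s ⊑ + n
even-gap {s} {n} s≤n (divides k gap≡) = evenGap k (cong +_ (begin
  n               ≡⟨ ℕₚ.m+[n∸m]≡n s≤n ⟨
  s + (n ∸ s)     ≡⟨ cong (s ℕ.+_) (trans (sym (dist-≥ s≤n)) gap≡) ⟩
  s + k * 2       ≡⟨ cong (s ℕ.+_) (twice k) ⟨
  s + (k + k)     ∎))

-- A natural number t ≡ n (mod 2) with t² < (n + 2)² satisfies t ⊑ n:
-- t ≤ n + 1, and t = n + 1 has the wrong parity.
bounded⁺ : ∀ {n t} → + 2 ∣ (+ n ℤ.- + t) → t * t < (2 + n) * (2 + n) → + t ⊑ + n
bounded⁺ {n} {t} 2∣n-t sq with t ℕ.≤? n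
... | yes t≤n = even-gap t≤n 2∣n-t
... | no  t≰n = ⊥-elim (2∤1 (subst (2 ℕ∣.∣_) odd-gap 2∣n-t))
  where
  t≡1+n : t ≡ suc n
  t≡1+n = ℕₚ.≤-antisym (ℕₚ.m<1+n⇒m≤n (square-cancel-< t (2 + n) sq)) (ℕₚ.≰⇒> t≰n)
  odd-gap : ∣ + n ℤ.- + t ∣ ≡ 1
  odd-gap rewrite t≡1+n = trans (dist-≤ (ℕₚ.n≤1+n n)) (ℕₚ.m+n∸n≡m 1 n)

bounded : ∀ {n} T → + 2 ∣ (+ n ℤ.- T) → T ℤ.* T ℤ.< + ((2 + n) * (2 + n)) →
          T ⊑ + n × ℤ.- T ⊑ + n
bounded {n} (+ t) 2∣n-t sq = t⊑n , ⊑-neg t⊑n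
  where
  t⊑n : + t ⊑ + n
  t⊑n = bounded⁺ 2∣n-t (ℤₚ.drop‿+<+ (subst (ℤ._< _) (sym (ℤₚ.pos-* t t)) sq))
bounded {n} -[1+ t ] 2∣n-T sq = ⊑-neg 1+t⊑n , 1+t⊑n
  where
  1+t⊑n : + suc t ⊑ + n
  1+t⊑n = bounded⁺ (parity-neg {T = -[1+ t ]} 2∣n-T) (ℤₚ.drop‿+<+ sq)

bound⇒full : ∀ {m n} → n ≤ m → m * n ≤ (2 + n) * (2 + n) → Full m n
bound⇒full {m} {n} n≤m mn≤ T = mk⇔
  (λ { (T∈S , T²<mn) → ⊑⇒parity (InS⇒⊑ T∈S) , T²<mn })
  (λ { (2∣n-T , T²<mn) → realise n≤m T (balanced 2∣n-T T²<mn) , T²<mn })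
  where
  balanced : + 2 ∣ (+ n ℤ.- T) → T ℤ.* T ℤ.< + (m * n) → T ⊑ + n × ℤ.- T ⊑ + n
  balanced 2∣n-T T²<mn = bounded T 2∣n-T (ℤₚ.<-≤-trans T²<mn (ℤ.+≤+ mn≤))

-- If (n + 2)² < m·n, then T = n + 2 lies in 𝒯_m(n) but not in 𝒮_m(n).
overflow : ∀ {m n} → (2 + n) * (2 + n) < m * n → ¬ Full m n
overflow {m} {n} mn> full = ℕₚ.m+1+n≰m n (subst (_≤ n) (ℕₚ.+-comm 2 n) 2+n≤n)
  where
  n+2∈T : InT m n (+ (2 + n))
  n+2∈T = subst (2 ℕ∣.∣_) (sym (trans (dist-≤ (ℕₚ.m≤n+m n 2)) (ℕₚ.m+n∸n≡m 2 n))) ℕ∣.∣-refl ,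
          subst (ℤ._< + (m * n)) (ℤₚ.pos-* (2 + n) (2 + n)) (ℤ.+<+ mn>)
  n+2∈S : InS m n (+ (2 + n))
  n+2∈S = proj₁ (Equivalence.from (full (+ (2 + n))) n+2∈T)
  2+n≤n : 2 + n ≤ n
  2+n≤n = ⊑⇒≤ (InS⇒⊑ n+2∈S)

full⇔bound : ∀ {m n} → n ≤ m → Full m n ⇔ m * n ≤ (2 + n) * (2 + n)
full⇔bound n≤m = mk⇔ (λ full → ℕₚ.≮⇒≥ (λ mn> → overflow mn> full)) (bound⇒full n≤m)

≤⇔≤ᵘ : ∀ {p q p′ q′} → ℚ.toℚᵘ p ℚᵘ.≃ p′ → ℚ.toℚᵘ q ℚᵘ.≃ q′ → p ℚ.≤ q ⇔ p′ ℚᵘ.≤ q′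
≤⇔≤ᵘ p≃ q≃ = mk⇔
  (λ p≤q → ℚᵘₚ.≤-respʳ-≃ q≃ (ℚᵘₚ.≤-respˡ-≃ p≃ (ℚₚ.toℚᵘ-mono-≤ p≤q)))
  (λ p′≤q′ → ℚₚ.toℚᵘ-cancel-≤ (ℚᵘₚ.≤-respʳ-≃ (ℚᵘₚ.≃-sym q≃) (ℚᵘₚ.≤-respˡ-≃ (ℚᵘₚ.≃-sym p≃) p′≤q′)))

toℚᵘ-/ : ∀ i d → ℚ.toℚᵘ (i / suc d) ℚᵘ.≃ ℚᵘ.mkℚᵘ i d
toℚᵘ-/ i d = ℚₚ.toℚᵘ-fromℚᵘ (ℚᵘ.mkℚᵘ i d)

rhs≃ : ∀ d → ℚ.toℚᵘ ((+ suc d / 1 ℚ.+ + 4 / 1) ℚ.+ + 4 / suc d) ℚᵘ.≃ ℚᵘ.mkℚᵘ (+ ((2 + suc d) * (2 + suc d))) d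
rhs≃ d = beginᵘ
  ℚ.toℚᵘ ((+ suc d / 1 ℚ.+ + 4 / 1) ℚ.+ + 4 / suc d)                    ≈⟨ ℚₚ.toℚᵘ-homo-+ (+ suc d / 1 ℚ.+ + 4 / 1) (+ 4 / suc d) ⟩
  ℚ.toℚᵘ (+ suc d / 1 ℚ.+ + 4 / 1) ℚᵘ.+ ℚ.toℚᵘ (+ 4 / suc d)           ≈⟨ ℚᵘₚ.+-cong (ℚₚ.toℚᵘ-homo-+ (+ suc d / 1) (+ 4 / 1)) (toℚᵘ-/ (+ 4) d) ⟩
  (ℚ.toℚᵘ (+ suc d / 1) ℚᵘ.+ ℚ.toℚᵘ (+ 4 / 1)) ℚᵘ.+ ℚᵘ.mkℚᵘ (+ 4) d   ≈⟨ ℚᵘₚ.+-cong (ℚᵘₚ.+-cong (toℚᵘ-/ (+ suc d) 0) (toℚᵘ-/ (+ 4) 0)) ℚᵘₚ.≃-refl ⟩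
  (ℚᵘ.mkℚᵘ (+ suc d) 0 ℚᵘ.+ ℚᵘ.mkℚᵘ (+ 4) 0) ℚᵘ.+ ℚᵘ.mkℚᵘ (+ 4) d    ≈⟨ ℚᵘ.*≡* (cong +_ (cross-multiply d)) ⟩
  ℚᵘ.mkℚᵘ (+ ((2 + suc d) * (2 + suc d))) d                             ∎ᵘ
  where
  open ℚᵘₚ.≃-Reasoning renaming (begin_ to beginᵘ_; _∎ to _∎ᵘ)
  -- the cross-multiplied numerators, in the shape fraction addition computes them
  cross-multiply : ∀ d → (1 + d + (d * 1 + 4) * (1 + d) + 4) * (1 + d) ≡ (3 + d) * (3 + d) * (1 * (1 + d))
  cross-multiply = solve-∀

integer-≤-fraction : ∀ m K d → ℚᵘ.mkℚᵘ (+ m) 0 ℚᵘ.≤ ℚᵘ.mkℚᵘ (+ K) d ⇔ m * suc d ≤ K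
integer-≤-fraction m K d = mk⇔
  (λ { (ℚᵘ.*≤* le) → ℤₚ.drop‿+≤+ (subst₂ ℤ._≤_ (sym (ℤₚ.pos-* m (suc d))) (ℤₚ.*-identityʳ (+ K)) le) })
  (λ le → ℚᵘ.*≤* (subst₂ ℤ._≤_ (ℤₚ.pos-* m (suc d)) (sym (ℤₚ.*-identityʳ (+ K))) (ℤ.+≤+ le)))

rational⇔bound : ∀ d m → (+ m / 1 ℚ.≤ (+ suc d / 1 ℚ.+ + 4 / 1) ℚ.+ + 4 / suc d)
                       ⇔ m * suc d ≤ (2 + suc d) * (2 + suc d)
rational⇔bound d m = integer-≤-fraction m _ d ⇔-∘ ≤⇔≤ᵘ (toℚᵘ-/ (+ m) 0) (rhs≃ d)

-- In particular 8n ≤ (n + 2)², the case a = 2 of AM–GM.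
eight-≤ : ∀ n → 8 * n ≤ (2 + n) * (2 + n)
eight-≤ n = subst (_≤ (2 + n) * (2 + n)) (sym (ℕₚ.*-assoc 4 2 n)) (am-gm 2 n)

corollary2p4 : ∀ (n m : ℕ) → .{{_ : NonZero n}} → .{{_ : NonZero m}} → n ≤ m →
    (Full m n ⇔ ((+ m / 1) ℚ.≤ ((+ n / 1) ℚ.+ (+ 4 / 1)) ℚ.+ (+ 4 / n)))
    × (m ≤ 8 → Full m n)
corollary2p4 n@(suc d) m n≤m =
  ⇔-sym (rational⇔bound d m) ⇔-∘ full⇔bound n≤m ,
  λ m≤8 → bound⇒full n≤m (ℕₚ.≤-trans (ℕₚ.*-monoˡ-≤ n m≤8) (eight-≤ n))
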